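{- Let $T$ be the Thue-Morse word and let $u_1, \dots, u_n$ be factors of $T$. If $\phi(u_1), \dots, \phi(u_n)$ are pairwise Abelian equivalent, then $u_1, \dots, u_n$ lie in at most $4$ different 2-Abelian equivalence classes.
   Context: The Thue-Morse word $T = 0110100110010110\cdots$ is the fixed point beginning with $0$ of the morphism $\tau(0) = 01$, $\tau(1) = 10$. For a word $w = a_1 \cdots a_n$ over $\{0,1\}$, $\phi(w) = b_1 \cdots b_{n-1}$ where $b_i = 0$ if $a_i a_{i+1} \in \{01, 10\}$ and $b_i = 1$ if $a_i a_{i+1} \in \{00, 11\}$. Two words are Abelian equivalent if each letter occurs equally often in both; they are 2-Abelian equivalent if every nonempty word of length at most $2$ occurs as a factor the same number of times in both. -}

module Defs where

open import Data.Bool using (Bool; true; false; if_then_else_)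
open import Data.Nat using (ℕ; zero; suc; _+_; _≤_)
open import Data.List using (List; []; _∷_; concatMap; drop; take; length; applyUpTo)
open import Data.List.Properties using (≡-dec)
import Data.Bool as B
open import Data.Fin using (Fin)
open import Data.Product using (∃; ∃-syntax; _×_)
open import Relation.Binary.PropositionalEquality using (_≡_)
open import Relation.Nullary using (does)

-- Letters: false = 0, true = 1.
Word : Set
Word = List Bool

τ : Bool → Word
τ false = false ∷ true ∷ []
τ true  = true ∷ false ∷ []

τ^ : ℕ → Word
τ^ zero    = false ∷ []
τ^ (suc k) = concatMap τ (τ^ k)

headOr : Word → Bool
headOr []      = false
headOr (a ∷ _) = a

-- T(i) = i-th letter (0-indexed) of the fixed point of τ beginning with 0;
-- τ^(i+1)(0) has length 2^(i+1) > i and is a prefix of T.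
T : ℕ → Bool
T i = headOr (drop i (τ^ (suc i)))

IsFactorOfT : Word → Set
IsFactorOfT u = ∃[ i ] u ≡ applyUpTo (λ k → T (i + k)) (length u)

φ : Word → Word
φ []           = []
φ (a ∷ [])     = []
φ (a ∷ b ∷ w)  = (if a B.xor b then false else true) ∷ φ (b ∷ w)

-- number of occurrences of w as a factor of u (w nonempty in all uses)
occ : Word → Word → ℕ
occ w []       = 0
occ w (a ∷ u)  =
  (if does (≡-dec B._≟_ (take (length w) (a ∷ u)) w) then 1 else 0) + occ w u

AbelianEq : Word → Word → Set
AbelianEq u v = (a : Bool) → occ (a ∷ []) u ≡ occ (a ∷ []) v

TwoAbelianEq : Word → Word → Set
TwoAbelianEq u v = (w : Word) → 1 ≤ length w → length w ≤ 2 → occ w u ≡ occ w v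

-- Every letter of a nonempty word u but the first ends a pair, so the 2-Abelian class of u is
-- fixed by its first letter and its four pair counts. The letters of φ(u) only reveal the sums
-- |u|₀₁ + |u|₁₀ (zeros) and |u|₀₀ + |u|₁₁ (ones). But the mixed pairs alternate, so
-- |u|₀₁ − |u|₁₀ is 0 or ±1 with the sign fixed by the first letter; and a factor of T is a prefix
-- of a τ-image, possibly preceded by one letter, so its repeated pairs straddle consecutive
-- τ-blocks and alternate as well: |u|₁₁ − |u|₀₀ is 0 or ±1 with a sign given by a bit q. A sum
-- together with such a constraint determines both summands, so the first letter and q fix the
-- class. Words of length at most 1 have empty φ-image and are sorted separately.
module Submission where

open import Defs
open import Algebra.Properties.CommutativeSemigroup using (interchange)
open import Data.Bool using (Bool; true; false; not; _≟_)
open import Data.Empty using (⊥-elim)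
open import Data.Fin using (Fin)
open import Data.Fin.Properties using (any?)
open import Data.List using ([]; _∷_; _++_; concatMap; drop; length; applyUpTo)
open import Data.List.Properties using (concatMap-++)
open import Data.Nat using (ℕ; zero; suc; _+_; _<_; z≤n; s≤s; ⌊_/2⌋; ⌈_/2⌉)
open import Data.Nat.Properties
  using (+-comm; +-suc; +-mono-≤; ≤-trans; ≤-<-trans; m≤m+n; m≤n⇒m≤1+n;
         n≡⌊n+n/2⌋; n≡⌈n+n/2⌉; +-commutativeSemigroup)
open import Data.Product using (Σ; ∃-syntax; _×_; _,_; proj₁; proj₂; swap)
import Data.Product.Properties as Product
open import Data.Sum using (_⊎_; inj₁; inj₂)
open import Function using (_∘_)
open import Relation.Binary.Definitions using (DecidableEquality)
open import Relation.Binary.PropositionalEquality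
open import Relation.Nullary using (¬_; yes; no)

count : Bool → Bool → Word → ℕ
count x y = occ (x ∷ y ∷ [])

Leads : ℕ → ℕ → Set
Leads x y = x ≡ y ⊎ x ≡ suc y

Balanced : Bool → ℕ → ℕ → Set
Balanced false x y = Leads x y
Balanced true  x y = Leads y x

balanced-zero : ∀ q → Balanced q 0 0
balanced-zero false = inj₁ refl
balanced-zero true  = inj₁ refl

leads-suc : ∀ {x y} → Leads y x → Leads (suc x) y
leads-suc (inj₁ y≡x)   = inj₂ (cong suc (sym y≡x))
leads-suc (inj₂ y≡1+x) = inj₁ (sym y≡1+x)

leads-halves : ∀ {x y} → Leads x y → x ≡ ⌈ x + y /2⌉ × y ≡ ⌊ x + y /2⌋
leads-halves {x}     (inj₁ refl) = n≡⌈n+n/2⌉ x , n≡⌊n+n/2⌋ x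
leads-halves {y = y} (inj₂ refl) = cong suc (n≡⌊n+n/2⌋ y) , n≡⌈n+n/2⌉ y

leads-unique : ∀ {x y x′ y′} → Leads x y → Leads x′ y′ → x + y ≡ x′ + y′ → x ≡ x′ × y ≡ y′
leads-unique l l′ s with leads-halves l | leads-halves l′
... | x≡ , y≡ | x′≡ , y′≡ =
  trans x≡ (trans (cong ⌈_/2⌉ s) (sym x′≡)) , trans y≡ (trans (cong ⌊_/2⌋ s) (sym y′≡))

balanced-unique : ∀ q {x y x′ y′} → Balanced q x y → Balanced q x′ y′ →
                  x + y ≡ x′ + y′ → x ≡ x′ × y ≡ y′
balanced-unique false b b′ s = leads-unique b b′ s
balanced-unique true {x} {y} {x′} {y′} b b′ s =
  swap (leads-unique b b′ (trans (+-comm y x) (trans s (+-comm x′ y′))))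

alternation : ∀ a w → Balanced a (count false true (a ∷ w)) (count true false (a ∷ w))
alternation false []          = inj₁ refl
alternation true  []          = inj₁ refl
alternation false (false ∷ w) = alternation false w
alternation false (true ∷ w)  = leads-suc (alternation true w)
alternation true  (false ∷ w) = leads-suc (alternation false w)
alternation true  (true ∷ w)  = alternation true w

occ-letter : ∀ b a w → occ (b ∷ []) (a ∷ w) ≡
             occ (b ∷ []) (a ∷ []) + (count false b (a ∷ w) + count true b (a ∷ w))
occ-letter false false []          = refl
occ-letter false true  []          = refl
occ-letter true  false []          = refl
occ-letter true  true  []          = refl
occ-letter false false (false ∷ w) = cong suc (occ-letter false false w)
occ-letter false false (true ∷ w)  = cong suc (occ-letter false true w)
occ-letter false true  (false ∷ w) = trans (occ-letter false false w) (sym (+-suc _ _))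
occ-letter false true  (true ∷ w)  = occ-letter false true w
occ-letter true  false (false ∷ w) = occ-letter true false w
occ-letter true  false (true ∷ w)  = occ-letter true true w
occ-letter true  true  (false ∷ w) = cong suc (occ-letter true false w)
occ-letter true  true  (true ∷ w)  = cong suc (trans (occ-letter true true w) (sym (+-suc _ _)))

occ-false-φ : ∀ u → occ (false ∷ []) (φ u) ≡ count false true u + count true false u
occ-false-φ []                  = refl
occ-false-φ (false ∷ [])        = refl
occ-false-φ (true ∷ [])         = refl
occ-false-φ (false ∷ false ∷ u) = occ-false-φ (false ∷ u)
occ-false-φ (false ∷ true ∷ u)  = cong suc (occ-false-φ (true ∷ u))
occ-false-φ (true ∷ false ∷ u)  = trans (cong suc (occ-false-φ (false ∷ u))) (sym (+-suc _ _))
occ-false-φ (true ∷ true ∷ u)   = occ-false-φ (true ∷ u)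

occ-true-φ : ∀ u → occ (true ∷ []) (φ u) ≡ count false false u + count true true u
occ-true-φ []                  = refl
occ-true-φ (false ∷ [])        = refl
occ-true-φ (true ∷ [])         = refl
occ-true-φ (false ∷ false ∷ u) = cong suc (occ-true-φ (false ∷ u))
occ-true-φ (false ∷ true ∷ u)  = occ-true-φ (true ∷ u)
occ-true-φ (true ∷ false ∷ u)  = occ-true-φ (false ∷ u)
occ-true-φ (true ∷ true ∷ u)   = trans (cong suc (occ-true-φ (true ∷ u))) (sym (+-suc _ _))

¬abelianEq-[]-∷ : ∀ x w → ¬ AbelianEq [] (x ∷ w)
¬abelianEq-[]-∷ false w ab with ab false
... | ()
¬abelianEq-[]-∷ true  w ab with ab true
... | ()

¬abelianEq-[]-φ : ∀ a b w → ¬ AbelianEq [] (φ (a ∷ b ∷ w))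
¬abelianEq-[]-φ a b w = ¬abelianEq-[]-∷ (headOr (φ (a ∷ b ∷ w))) (φ (b ∷ w))

DiagBalanced : Bool → Word → Set
DiagBalanced q u = Balanced q (count false false u) (count true true u)

diagBalanced-single : ∀ q a → DiagBalanced q (a ∷ [])
diagBalanced-single q false = balanced-zero q
diagBalanced-single q true  = balanced-zero q

φ-abelian⇒2-abelian : ∀ {q a w w′} → DiagBalanced q (a ∷ w) → DiagBalanced q (a ∷ w′) →
                      AbelianEq (φ (a ∷ w)) (φ (a ∷ w′)) → TwoAbelianEq (a ∷ w) (a ∷ w′)
φ-abelian⇒2-abelian {q} {a} {w} {w′} diag diag′ φ≈ = equal-occ
  where
  u v : Word
  u = a ∷ w
  v = a ∷ w′

  mixed : count false true u ≡ count false true v × count true false u ≡ count true false v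
  mixed = balanced-unique a (alternation a w) (alternation a w′)
    (trans (sym (occ-false-φ u)) (trans (φ≈ false) (occ-false-φ v)))

  repeated : count false false u ≡ count false false v × count true true u ≡ count true true v
  repeated = balanced-unique q diag diag′
    (trans (sym (occ-true-φ u)) (trans (φ≈ true) (occ-true-φ v)))

  equal-count : ∀ x y → count x y u ≡ count x y v
  equal-count false false = proj₁ repeated
  equal-count true  true  = proj₂ repeated
  equal-count false true  = proj₁ mixed
  equal-count true  false = proj₂ mixed

  equal-occ : TwoAbelianEq u v
  equal-occ (b ∷ []) _ _ = begin
    occ (b ∷ []) u                                             ≡⟨ occ-letter b a w ⟩
    occ (b ∷ []) (a ∷ []) + (count false b u + count true b u)
      ≡⟨ cong₂ (λ m n → occ (b ∷ []) (a ∷ []) + (m + n)) (equal-count false b) (equal-count true b) ⟩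
    occ (b ∷ []) (a ∷ []) + (count false b v + count true b v) ≡⟨ occ-letter b a w′ ⟨
    occ (b ∷ []) v                                             ∎
    where open ≡-Reasoning
  equal-occ (x ∷ y ∷ [])    _ _               = equal-count x y
  equal-occ (x ∷ y ∷ z ∷ _) _ (s≤s (s≤s ()))

-- The prefixes of τ-images: τ(x), possibly followed by one letter.
data Tiled : Word → Set where
  empty  : Tiled []
  single : ∀ a → Tiled (a ∷ [])
  block  : ∀ a {w} → Tiled w → Tiled (a ∷ not a ∷ w)

mutual
  tiled-diagBalanced : ∀ {u} → Tiled u → DiagBalanced (not (headOr u)) u
  tiled-diagBalanced empty           = balanced-zero true
  tiled-diagBalanced (single a)      = diagBalanced-single (not a) a
  tiled-diagBalanced (block false t) = cons-tiled-diagBalanced true t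
  tiled-diagBalanced (block true t)  = cons-tiled-diagBalanced false t

  cons-tiled-diagBalanced : ∀ b {w} → Tiled w → DiagBalanced b (b ∷ w)
  cons-tiled-diagBalanced b     {[]}        t = diagBalanced-single b b
  cons-tiled-diagBalanced false {false ∷ w} t = leads-suc (tiled-diagBalanced t)
  cons-tiled-diagBalanced false {true ∷ w}  t = tiled-diagBalanced t
  cons-tiled-diagBalanced true  {false ∷ w} t = tiled-diagBalanced t
  cons-tiled-diagBalanced true  {true ∷ w}  t = leads-suc (tiled-diagBalanced t)

record IsτImage (g : ℕ → Bool) : Set where
  constructor τImage
  field odd≡not-even : ∀ k → g (suc (k + k)) ≡ not (g (k + k))

τImage-cong : ∀ {f g} → (∀ k → f k ≡ g k) → IsτImage f → IsτImage g
τImage-cong f≗g (τImage alt) = τImage λ k → trans (sym (f≗g _)) (trans (alt k) (cong not (f≗g _)))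

τImage-shift : ∀ {g} → IsτImage g → ∀ j → IsτImage (λ k → g (j + j + k))
τImage-shift {g} (τImage alt) j = τImage shifted
  where
  shifted : ∀ k → g (j + j + suc (k + k)) ≡ not (g (j + j + (k + k)))
  shifted k = subst₂ (λ m n → g m ≡ not (g n))
                     (trans (cong suc even) (sym (+-suc (j + j) (k + k)))) even (alt (j + k))
    where
    even : (j + k) + (j + k) ≡ j + j + (k + k)
    even = interchange +-commutativeSemigroup j k j k

τImage-drop₂ : ∀ {g} → IsτImage g → IsτImage (λ k → g (suc (suc k)))
τImage-drop₂ {g} (τImage alt) = τImage dropped
  where
  dropped : ∀ k → g (suc (suc (suc (k + k)))) ≡ not (g (suc (suc (k + k))))
  dropped k rewrite sym (+-suc k k) = alt (suc k)

applyUpTo-tiled : ∀ {g} → IsτImage g → ∀ m → Tiled (applyUpTo g m)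
applyUpTo-tiled     img zero          = empty
applyUpTo-tiled {g} img (suc zero)    = single (g 0)
applyUpTo-tiled {g} img (suc (suc m)) rewrite IsτImage.odd≡not-even img 0 =
  block (g 0) (applyUpTo-tiled (τImage-drop₂ img) m)

letter : Word → ℕ → Bool
letter w i = headOr (drop i w)

letter-++ˡ : ∀ {x} y {i} → i < length x → letter (x ++ y) i ≡ letter x i
letter-++ˡ {a ∷ x} y {zero}  _        = refl
letter-++ˡ {a ∷ x} y {suc i} (s≤s i<) = letter-++ˡ y i<

letter-τ-even : ∀ w k → letter (concatMap τ w) (k + k) ≡ letter w k
letter-τ-even []          zero    = refl
letter-τ-even []          (suc k) = refl
letter-τ-even (false ∷ w) zero    = refl
letter-τ-even (true ∷ w)  zero    = refl
letter-τ-even (false ∷ w) (suc k) rewrite +-suc k k = letter-τ-even w k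
letter-τ-even (true ∷ w)  (suc k) rewrite +-suc k k = letter-τ-even w k

letter-τ-odd : ∀ w {k} → k < length w → letter (concatMap τ w) (suc (k + k)) ≡ not (letter w k)
letter-τ-odd (false ∷ w) {zero}  _        = refl
letter-τ-odd (true ∷ w)  {zero}  _        = refl
letter-τ-odd (false ∷ w) {suc k} (s≤s k<) rewrite +-suc k k = letter-τ-odd w k<
letter-τ-odd (true ∷ w)  {suc k} (s≤s k<) rewrite +-suc k k = letter-τ-odd w k<

length-concatMap-τ : ∀ w → length (concatMap τ w) ≡ length w + length w
length-concatMap-τ []          = refl
length-concatMap-τ (false ∷ w) = cong suc (trans (cong suc (length-concatMap-τ w)) (sym (+-suc _ _)))
length-concatMap-τ (true ∷ w)  = cong suc (trans (cong suc (length-concatMap-τ w)) (sym (+-suc _ _)))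

n<length-τ^ : ∀ n → n < length (τ^ n)
n<length-τ^ zero    = s≤s z≤n
n<length-τ^ (suc n) rewrite length-concatMap-τ (τ^ n) =
  +-mono-≤ (≤-trans (s≤s z≤n) (n<length-τ^ n)) (n<length-τ^ n)

τ^-prefix : ∀ n → ∃[ r ] τ^ (suc n) ≡ τ^ n ++ r
τ^-prefix zero    = true ∷ [] , refl
τ^-prefix (suc n) with τ^-prefix n
... | r , eq = concatMap τ r , trans (cong (concatMap τ) eq) (concatMap-++ τ (τ^ n) r)

letter-τ^-suc : ∀ n {i} → i < length (τ^ n) → letter (τ^ (suc n)) i ≡ letter (τ^ n) i
letter-τ^-suc n i< with τ^-prefix n
... | r , eq rewrite eq = letter-++ˡ r i<

T-odd≡not-even : ∀ k → T (suc (k + k)) ≡ not (T (k + k))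
T-odd≡not-even k = begin
  letter (concatMap τ (τ^ (suc (k + k)))) (suc (k + k))
    ≡⟨ letter-τ-odd (τ^ (suc (k + k))) (≤-<-trans (m≤n⇒m≤1+n (m≤m+n k k)) (n<length-τ^ _)) ⟩
  not (letter (τ^ (suc (k + k))) k)
    ≡⟨ cong not (letter-τ^-suc (k + k) (≤-<-trans (m≤m+n k k) (n<length-τ^ _))) ⟩
  not (letter (τ^ (k + k)) k)
    ≡⟨ cong not (letter-τ-even (τ^ (k + k)) k) ⟨
  not (letter (concatMap τ (τ^ (k + k))) (k + k))
    ∎
  where open ≡-Reasoning

T-τImage : IsτImage T
T-τImage = τImage T-odd≡not-even

data Parity : ℕ → Set where
  even : ∀ j → Parity (j + j)
  odd  : ∀ j → Parity (suc (j + j))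

parity : ∀ n → Parity n
parity zero = even 0
parity (suc n) with parity n
... | even j = odd j
... | odd j  = subst Parity (cong suc (+-suc j j)) (even (suc j))

window-diagBalanced : ∀ {i} → Parity i → ∀ m →
                      ∃[ q ] DiagBalanced q (applyUpTo (λ k → T (i + k)) m)
window-diagBalanced (even j) m = _ , tiled-diagBalanced (applyUpTo-tiled (τImage-shift T-τImage j) m)
window-diagBalanced (odd j) zero    = false , balanced-zero false
window-diagBalanced (odd j) (suc m) = _ , cons-tiled-diagBalanced (T (suc (j + j) + 0)) (applyUpTo-tiled tail-τImage m)
  where
  reindex : ∀ k → T (suc j + suc j + k) ≡ T (suc (j + j) + suc k)
  reindex k = cong (λ n → T (suc n)) (trans (cong (_+ k) (+-suc j j)) (sym (+-suc (j + j) k)))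

  tail-τImage : IsτImage (λ k → T (suc (j + j) + suc k))
  tail-τImage = τImage-cong reindex (τImage-shift T-τImage (suc j))

factor-diagBalanced : ∀ {u} → IsFactorOfT u → ∃[ q ] DiagBalanced q u
factor-diagBalanced {u} (i , u≡window) =
  subst (λ w → ∃[ q ] DiagBalanced q w) (sym u≡window) (window-diagBalanced (parity i) (length u))

-- The empty word and the single letters all have φ-image [], so they get keys of their own;
-- a longer word has a nonempty φ-image and can never share a key with them.
key : Bool → Word → Bool × Bool
key q []          = false , false
key q (a ∷ [])    = true , a
key q (a ∷ _ ∷ _) = q , a

same-key⇒2-abelian : ∀ {q q′ u v} → DiagBalanced q u → DiagBalanced q′ v → key q u ≡ key q′ v →
                     AbelianEq (φ u) (φ v) → TwoAbelianEq u v
same-key⇒2-abelian {u = []}        {[]}        _ _ _ _ = λ _ _ _ → refl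
same-key⇒2-abelian {u = []}        {b ∷ []}    _ _ () _
same-key⇒2-abelian {u = []}        {b ∷ c ∷ v} _ _ _ φ≈ = ⊥-elim (¬abelianEq-[]-φ b c v φ≈)
same-key⇒2-abelian {u = a ∷ []}    {[]}        _ _ () _
same-key⇒2-abelian {u = a ∷ []}    {.a ∷ []}   _ _ refl _ = λ _ _ _ → refl
same-key⇒2-abelian {u = a ∷ []}    {b ∷ c ∷ v} _ _ _ φ≈ = ⊥-elim (¬abelianEq-[]-φ b c v φ≈)
same-key⇒2-abelian {u = a ∷ b ∷ u} {[]}         _ _ _ φ≈ = ⊥-elim (¬abelianEq-[]-φ a b u (sym ∘ φ≈))
same-key⇒2-abelian {u = a ∷ b ∷ u} {c ∷ []}     _ _ _ φ≈ = ⊥-elim (¬abelianEq-[]-φ a b u (sym ∘ φ≈))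
same-key⇒2-abelian {u = a ∷ b ∷ u} {.a ∷ c ∷ v} diag diag′ refl φ≈ = φ-abelian⇒2-abelian diag diag′ φ≈

representatives : ∀ {A K : Set} → DecidableEquality K → A →
                  ∀ {n} (κ : Fin n → K) (u : Fin n → A) →
                  Σ (K → A) λ V → ∀ i → ∃[ j ] κ j ≡ κ i × V (κ i) ≡ u j
representatives {A} {K} _≟ᴷ_ default κ u = V , represented
  where
  V : K → A
  V k with any? (λ j → κ j ≟ᴷ k)
  ... | yes (j , _) = u j
  ... | no _        = default

  represented : ∀ i → ∃[ j ] κ j ≡ κ i × V (κ i) ≡ u j
  represented i with any? (λ j → κ j ≟ᴷ κ i)
  ... | yes (j , κj≡κi) = j , κj≡κi , refl
  ... | no ¬∃           = ⊥-elim (¬∃ (i , refl))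

Bool²-cover : ∀ (P : Bool × Bool → Set) k → P k →
              P (false , false) ⊎ P (false , true) ⊎ P (true , false) ⊎ P (true , true)
Bool²-cover P (false , false) p = inj₁ p
Bool²-cover P (false , true)  p = inj₂ (inj₁ p)
Bool²-cover P (true , false)  p = inj₂ (inj₂ (inj₁ p))
Bool²-cover P (true , true)   p = inj₂ (inj₂ (inj₂ p))

lemma8 : (n : ℕ) (u : Fin n → Word) →
    ((i : Fin n) → IsFactorOfT (u i)) →
    ((i j : Fin n) → AbelianEq (φ (u i)) (φ (u j))) →
    ∃[ v₁ ] ∃[ v₂ ] ∃[ v₃ ] ∃[ v₄ ]
      ((i : Fin n) → TwoAbelianEq (u i) v₁ ⊎ TwoAbelianEq (u i) v₂
                     ⊎ TwoAbelianEq (u i) v₃ ⊎ TwoAbelianEq (u i) v₄)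
lemma8 n u factor φ≈ =
  V (false , false) , V (false , true) , V (true , false) , V (true , true) ,
  λ i → Bool²-cover (λ k → TwoAbelianEq (u i) (V k)) (κ i) (equivalent-to-representative i)
  where
  q : Fin n → Bool
  q i = proj₁ (factor-diagBalanced (factor i))

  κ : Fin n → Bool × Bool
  κ i = key (q i) (u i)

  chosen : Σ (Bool × Bool → Word) λ V → ∀ i → ∃[ j ] κ j ≡ κ i × V (κ i) ≡ u j
  chosen = representatives (Product.≡-dec _≟_ _≟_) [] κ u

  V : Bool × Bool → Word
  V = proj₁ chosen

  equivalent-to-representative : ∀ i → TwoAbelianEq (u i) (V (κ i))
  equivalent-to-representative i with proj₂ chosen i
  ... | j , κj≡κi , Vκi≡uj rewrite Vκi≡uj =
    same-key⇒2-abelian (proj₂ (factor-diagBalanced (factor i))) (proj₂ (factor-diagBalanced (factor j)))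
                       (sym κj≡κi) (φ≈ i j)
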